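{- Let $\mathcal{T}$ be a standard single-elimination tournament on $n$ players, where $n\ge 2$ is a power of $2$. Then for every scoring system $\sigma$ on $\mathcal{T}$ we have $\dim(\mathcal{T},\sigma)=\frac{n}{2}$. Moreover, for every such $n$ there exists a set $\mathcal{B}$ of $n/2$ brackets of $\mathcal{T}$ which is $\sigma$-resolving for every scoring system $\sigma$ on $\mathcal{T}$.
   Context: For a digraph, $N^+(v)$ is the set of out-neighbours of $v$ and $N^-(v)$ the set of in-neighbours; a sink has $N^+(v)=\emptyset$, a source has $N^-(v)=\emptyset$. A single-elimination tournament $\mathcal{T}$ is a finite digraph with: exactly one sink; $|N^+(v)|=1$ for every non-sink $v$; no directed cycles; and $|N^-(v)|\ne 1$ for every vertex $v$. Players $P(\mathcal{T})$ are the sources; matches $M(\mathcal{T})$ are the non-sources. $\mathcal{T}$ is standard if it is obtained from a complete binary tree by orienting all edges towards its center (root). A bracket is a function $B:V(\mathcal{T})\to P(\mathcal{T})$ with $B(a)=a$ for every player $a$ and $B(x)\in\{B(u):u\in N^-(x)\}$ for every match $x$. A scoring system is a function $\sigma:M(\mathcal{T})\to\mathbb{R}_{>0}$. For brackets $B,B'$, $\mathrm{score}_\sigma(B,B')=\sum_{x\in M(\mathcal{T}):B(x)=B'(x)}\sigma(x)$. A set of brackets $\mathcal{B}$ is $\sigma$-resolving if for all pairs of distinct brackets $B,B'$ there is $B_i\in\mathcal{B}$ with $\mathrm{score}_\sigma(B_i,B)\ne\mathrm{score}_\sigma(B_i,B')$. $\dim(\mathcal{T},\sigma)$ is the minimum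 size of a $\sigma$-resolving set. -}

module Defs where

open import Data.Nat using (ℕ; zero; suc; _^_; _≤_)
open import Data.Fin using (Fin)
open import Data.List using (List; []; _∷_; map; _++_; foldr)
open import Data.Product using (Σ; ∃; _×_; _,_)
open import Data.Empty using (⊥)
open import Data.Sum using (_⊎_; inj₁; inj₂)
open import Relation.Nullary using (¬_; Dec; yes; no)
open import Relation.Binary.PropositionalEquality using (_≡_; _≢_; refl; cong)

-- Scalars.  The paper's scores are positive reals; agda-stdlib has no
-- reals, so we quantify over an arbitrary ordered field (ℝ is one).

record OrderedField : Set₁ where
  infixl 6 _+_
  infixl 7 _*_
  infix 4 _<_
  field
    Carrier : Set
    _+_ _*_ : Carrier → Carrier → Carrier
    -_      : Carrier → Carrier
    0# 1#   : Carrier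
    _⁻¹     : Carrier → Carrier
    _<_     : Carrier → Carrier → Set
    +-assoc   : ∀ x y z → (x + y) + z ≡ x + (y + z)
    +-comm    : ∀ x y → x + y ≡ y + x
    +-identityˡ : ∀ x → 0# + x ≡ x
    -‿inverseˡ : ∀ x → (- x) + x ≡ 0#
    *-assoc   : ∀ x y z → (x * y) * z ≡ x * (y * z)
    *-comm    : ∀ x y → x * y ≡ y * x
    *-identityˡ : ∀ x → 1# * x ≡ x
    distribˡ  : ∀ x y z → x * (y + z) ≡ (x * y) + (x * z)
    ⁻¹-inverseˡ : ∀ x → x ≢ 0# → (x ⁻¹) * x ≡ 1#
    0≢1       : 0# ≢ 1#
    <-irrefl  : ∀ x → ¬ (x < x)
    <-trans   : ∀ x y z → x < y → y < z → x < z
    <-trichotomy : ∀ x y → (x < y) ⊎ ((x ≡ y) ⊎ (y < x))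
    +-mono-<  : ∀ x y z → x < y → (x + z) < (y + z)
    *-pos     : ∀ x y → 0# < x → 0# < y → 0# < (x * y)

-- The standard single-elimination tournament of depth d
-- (n = 2 ^ d players): the complete binary tree with all edges
-- oriented towards the root.

data V : ℕ → Set where
  leaf : V 0
  root : ∀ {k} → V (suc k)
  inL  : ∀ {k} → V k → V (suc k)
  inR  : ∀ {k} → V k → V (suc k)

top : (k : ℕ) → V k
top zero    = leaf
top (suc k) = root

data Edge : ∀ {k} → V k → V k → Set where
  eL    : ∀ {k} → Edge (inL (top k)) (root {k})
  eR    : ∀ {k} → Edge (inR (top k)) (root {k})
  liftL : ∀ {k} {u x : V k} → Edge u x → Edge (inL u) (inL x)
  liftR : ∀ {k} {u x : V k} → Edge u x → Edge (inR u) (inR x)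

IsPlayer : ∀ {k} → V k → Set
IsPlayer {k} v = (u : V k) → ¬ Edge u v

IsMatch : ∀ {k} → V k → Set
IsMatch {k} x = Σ (V k) (λ u → Edge u x)

isMatch? : ∀ {k} (x : V k) → Dec (IsMatch x)
isMatch? leaf = no λ { (_ , ()) }
isMatch? (root {k}) = yes (inL (top k) , eL)
isMatch? (inL x) with isMatch? x
... | yes (u , e) = yes (inL u , liftL e)
... | no ¬m = no λ { (inL u , liftL e) → ¬m (u , e) }
isMatch? (inR x) with isMatch? x
... | yes (u , e) = yes (inR u , liftR e)
... | no ¬m = no λ { (inR u , liftR e) → ¬m (u , e) }

vertices : (k : ℕ) → List (V k)
vertices zero    = leaf ∷ []
vertices (suc k) = root ∷ (map inL (vertices k) ++ map inR (vertices k))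

inL-inj : ∀ {k} {x y : V k} → inL x ≡ inL y → x ≡ y
inL-inj refl = refl

inR-inj : ∀ {k} {x y : V k} → inR x ≡ inR y → x ≡ y
inR-inj refl = refl

_≟V_ : ∀ {k} (x y : V k) → Dec (x ≡ y)
leaf ≟V leaf = yes refl
root ≟V root = yes refl
root ≟V inL y = no λ ()
root ≟V inR y = no λ ()
inL x ≟V root = no λ ()
inL x ≟V inL y with x ≟V y
... | yes refl = yes refl
... | no ne = no λ e → ne (inL-inj e)
inL x ≟V inR y = no λ ()
inR x ≟V root = no λ ()
inR x ≟V inL y = no λ ()
inR x ≟V inR y with x ≟V y
... | yes refl = yes refl
... | no ne = no λ e → ne (inR-inj e)

record Bracket (k : ℕ) : Set where
  field
    fn        : V k → V k
    toPlayer  : ∀ v → IsPlayer (fn v)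
    onPlayer  : ∀ a → IsPlayer a → fn a ≡ a
    onMatch   : ∀ x → IsMatch x → Σ (V k) (λ u → Edge u x × fn x ≡ fn u)
open Bracket public

-- Scoring systems and scores (over an ordered field F).
-- A scoring system is a map σ : V k → F that is positive on matches
-- (its values on players are never used).

module _ (F : OrderedField) where
  open OrderedField F

  ScoringSystem : ℕ → Set
  ScoringSystem k = V k → Carrier

  Positive : ∀ {k} → ScoringSystem k → Set
  Positive {k} σ = (x : V k) → IsMatch x → 0# < σ x

  score : ∀ {k} → ScoringSystem k → Bracket k → Bracket k → Carrier
  score {k} σ B B' = foldr _+_ 0# (map contrib (vertices k))
    where
    contrib : V k → Carrier
    contrib x with isMatch? x | fn B x ≟V fn B' x
    ... | yes _ | yes _ = σ x
    ... | _     | _     = 0#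

  Distinct : ∀ {k} → Bracket k → Bracket k → Set
  Distinct {k} B B' = ¬ ((v : V k) → fn B v ≡ fn B' v)

  Resolving : ∀ {k m} → ScoringSystem k → (Fin m → Bracket k) → Set
  Resolving {k} {m} σ ℬ = (B B' : Bracket k) → Distinct B B' →
    Σ (Fin m) (λ i → score σ (ℬ i) B ≢ score σ (ℬ i) B')

  DimEq : ∀ {k} → ScoringSystem k → ℕ → Set
  DimEq {k} σ d =
    Σ (Fin d → Bracket k) (λ ℬ → Resolving σ ℬ) ×
    ((m : ℕ) (ℬ : Fin m → Bracket k) → Resolving σ ℬ → d ≤ m)

{-# OPTIONS --safe #-}
module Submission where

-- Lower bound: if fewer than n/2 brackets are given, some player of each half is
-- predicted champion by none of them, and the two brackets that differ only in which
-- of these two finalists wins the final score equally against all of them.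
--
-- Upper bound: for each player p of the left half take the bracket in which p wins
-- the left half and the final, every other left-half match goes to its leftmost
-- player, and the right half is, recursively, the bracket of the half-size family for
-- p with its last move forgotten.  Two sibling players then share the right half, so
-- the difference of their scores against a bracket b depends only on the left half
-- and the final of b.  Descending along the paths of the sibling pairs, these
-- differences determine the left half of b and its final: positivity of the scores
-- rules out any cancellation.  The right half is then found by induction on the depth.

open import Defs
open import Data.Nat using (ℕ; zero; suc; _^_)
import Data.Nat as ℕ
import Data.Nat.Properties as ℕ
open import Data.Bool using (Bool; true; false; not; _∧_; if_then_else_)
open import Data.Empty using (⊥-elim)
open import Data.Fin using (Fin; remQuot; combine)
import Data.Fin as Fin
open import Data.Fin.Properties using (remQuot-combine; ¬∀⟶∃¬)
open import Data.List using (List; []; _∷_; _++_; map; foldr; length; tabulate)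
open import Data.List.Properties using (length-tabulate; map-∘; map-cong)
open import Data.List.Membership.Propositional using (_∈_; _∉_)
open import Data.List.Membership.Propositional.Properties using (∈-tabulate⁺)
open import Data.List.Relation.Unary.Any using (here; there)
open import Data.Product using (Σ; ∃; _×_; _,_; proj₁; proj₂)
open import Data.Sum using (_⊎_; inj₁; inj₂)
open import Function using (_∘_; id)
open import Level using (0ℓ)
open import Relation.Nullary using (¬_; yes; no; does)
open import Relation.Nullary.Decidable using (dec-false)
open import Relation.Binary.Definitions using (DecidableEquality)
open import Relation.Binary.PropositionalEquality
open import Algebra.Bundles using (AbelianGroup)
open import Algebra.Consequences.Propositional using (comm∧idˡ⇒id; comm∧invˡ⇒inv)
import Algebra.Properties.AbelianGroup as AbelianGroupProperties
import Algebra.Properties.CommutativeSemigroup as CommutativeSemigroupProperties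

leaf-player : IsPlayer leaf
leaf-player _ ()

player-inL : ∀ {k} {v : V k} → IsPlayer v → IsPlayer (inL v)
player-inL v-player _ (liftL e) = v-player _ e

player-inR : ∀ {k} {v : V k} → IsPlayer v → IsPlayer (inR v)
player-inR v-player _ (liftR e) = v-player _ e

player-unL : ∀ {k} {v : V k} → IsPlayer (inL v) → IsPlayer v
player-unL inL-player u e = inL-player (inL u) (liftL e)

player-unR : ∀ {k} {v : V k} → IsPlayer (inR v) → IsPlayer v
player-unR inR-player u e = inR-player (inR u) (liftR e)

root-not-player : ∀ {k} → ¬ IsPlayer (root {k})
root-not-player {k} root-player = root-player (inL (top k)) eL

inL≢inR : ∀ {k} {a b : V k} → inL a ≢ inR b
inL≢inR ()

does-isMatch?-inL : ∀ {k} (x : V k) → does (isMatch? (inL x)) ≡ does (isMatch? x)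
does-isMatch?-inL x with isMatch? x
... | yes _ = refl
... | no _  = refl

does-isMatch?-inR : ∀ {k} (x : V k) → does (isMatch? (inR x)) ≡ does (isMatch? x)
does-isMatch?-inR x with isMatch? x
... | yes _ = refl
... | no _  = refl

does-≟V-inL : ∀ {k} (a b : V k) → does (inL a ≟V inL b) ≡ does (a ≟V b)
does-≟V-inL a b with a ≟V b
... | yes refl = refl
... | no _     = refl

does-≟V-inR : ∀ {k} (a b : V k) → does (inR a ≟V inR b) ≡ does (a ≟V b)
does-≟V-inR a b with a ≟V b
... | yes refl = refl
... | no _     = refl

data Picks : ℕ → Set where
  done : Picks zero
  node : ∀ {k} → (leftWins : Bool) → Picks k → Picks k → Picks (suc k)

champion : ∀ {k} → Picks k → V k
champion done            = leaf
champion (node true l _)  = inL (champion l)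
champion (node false _ r) = inR (champion r)

winner : ∀ {k} → Picks k → V k → V k
winner done           _       = leaf
winner b@(node _ _ _) root    = champion b
winner (node _ l _)   (inL v) = inL (winner l v)
winner (node _ _ r)   (inR v) = inR (winner r v)

winner-top : ∀ {k} (b : Picks k) → winner b (top k) ≡ champion b
winner-top done         = refl
winner-top (node _ _ _) = refl

does-≟-champion-inL : ∀ {k} (a : V k) t (l r : Picks k) →
  does (inL a ≟V champion (node t l r)) ≡ t ∧ does (a ≟V champion l)
does-≟-champion-inL a true  l _ = does-≟V-inL a (champion l)
does-≟-champion-inL a false _ _ = refl

does-≟-champion-inR : ∀ {k} (a : V k) t (l r : Picks k) →
  does (inR a ≟V champion (node t l r)) ≡ not t ∧ does (a ≟V champion r)
does-≟-champion-inR a true  _ _ = refl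
does-≟-champion-inR a false _ r = does-≟V-inR a (champion r)

champion-isPlayer : ∀ {k} (b : Picks k) → IsPlayer (champion b)
champion-isPlayer done             = leaf-player
champion-isPlayer (node true l _)  = player-inL (champion-isPlayer l)
champion-isPlayer (node false _ r) = player-inR (champion-isPlayer r)

winner-isPlayer : ∀ {k} (b : Picks k) v → IsPlayer (winner b v)
winner-isPlayer done         leaf    = leaf-player
winner-isPlayer (node s l r) root    = champion-isPlayer (node s l r)
winner-isPlayer (node _ l _) (inL v) = player-inL (winner-isPlayer l v)
winner-isPlayer (node _ _ r) (inR v) = player-inR (winner-isPlayer r v)

winner-onPlayer : ∀ {k} (b : Picks k) a → IsPlayer a → winner b a ≡ a
winner-onPlayer done         leaf    _        = refl
winner-onPlayer (node _ _ _) root    a-player = ⊥-elim (root-not-player a-player)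
winner-onPlayer (node _ l _) (inL a) a-player = cong inL (winner-onPlayer l a (player-unL a-player))
winner-onPlayer (node _ _ r) (inR a) a-player = cong inR (winner-onPlayer r a (player-unR a-player))

Inherits : ∀ {A : Set} {k} → (V k → A) → Set
Inherits {k = k} f = ∀ x → IsMatch x → Σ (V k) λ u → Edge u x × f x ≡ f u

inherits-inL : ∀ {A : Set} {k} {f : V (suc k) → A} → Inherits f → Inherits (f ∘ inL)
inherits-inL inherits x (u , e) with inherits (inL x) (inL u , liftL e)
... | inL u′ , liftL e′ , eq = u′ , e′ , eq

inherits-inR : ∀ {A : Set} {k} {f : V (suc k) → A} → Inherits f → Inherits (f ∘ inR)
inherits-inR inherits x (u , e) with inherits (inR x) (inR u , liftR e)
... | inR u′ , liftR e′ , eq = u′ , e′ , eq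

winner-inherits : ∀ {k} (b : Picks k) → Inherits (winner b)
winner-inherits done leaf (_ , ())
winner-inherits (node true l _)  root _ = inL (top _) , eL , cong inL (sym (winner-top l))
winner-inherits (node false _ r) root _ = inR (top _) , eR , cong inR (sym (winner-top r))
winner-inherits (node _ l _) (inL x) (inL u , liftL e) with winner-inherits l x (u , e)
... | u′ , e′ , eq = inL u′ , liftL e′ , cong inL eq
winner-inherits (node _ _ r) (inR x) (inR u , liftR e) with winner-inherits r x (u , e)
... | u′ , e′ , eq = inR u′ , liftR e′ , cong inR eq

toBracket : ∀ {k} → Picks k → Bracket k
toBracket b = record
  { fn       = winner b
  ; toPlayer = winner-isPlayer b
  ; onPlayer = winner-onPlayer b
  ; onMatch  = winner-inherits b
  }

-- Generalising from brackets (e = id) to an arbitrary labelling e of the players lets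
-- the induction pass to the subtrees, where the labels become e ∘ inL and e ∘ inR.
factors-through-winner : ∀ {A : Set} k (e f : V k → A) →
  (∀ a → IsPlayer a → f a ≡ e a) → Inherits f → Σ (Picks k) λ b → ∀ v → f v ≡ e (winner b v)
factors-through-winner zero e f on-players _ = done , λ { leaf → on-players leaf leaf-player }
factors-through-winner (suc k) e f on-players inherits
  with factors-through-winner k (e ∘ inL) (f ∘ inL) (λ a → on-players (inL a) ∘ player-inL)
                              (inherits-inL inherits)
     | factors-through-winner k (e ∘ inR) (f ∘ inR) (λ a → on-players (inR a) ∘ player-inR)
                              (inherits-inR inherits)
... | l , f≡l | r , f≡r =
  let s , f-root = side (inherits root (inL (top k) , eL))
  in node s l r , λ { root → f-root ; (inL v) → f≡l v ; (inR v) → f≡r v }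
  where
  side : Σ (V (suc k)) (λ u → Edge u root × f root ≡ f u) → Σ Bool λ s → f root ≡ e (champion (node s l r))
  side (_ , eL , eq) = true  , trans eq (trans (f≡l (top k)) (cong (e ∘ inL) (winner-top l)))
  side (_ , eR , eq) = false , trans eq (trans (f≡r (top k)) (cong (e ∘ inR) (winner-top r)))

picks : ∀ {k} → Bracket k → Picks k
picks {k} B = proj₁ (factors-through-winner k id (fn B) (onPlayer B) (onMatch B))

picks-correct : ∀ {k} (B : Bracket k) → fn B ≗ winner (picks B)
picks-correct {k} B = proj₂ (factors-through-winner k id (fn B) (onPlayer B) (onMatch B))

allLeft : ∀ {k} → Picks k
allLeft {zero}  = done
allLeft {suc k} = node true allLeft allLeft

favouring : ∀ {k} → V k → Picks k
favouring leaf    = done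
favouring root    = allLeft
favouring (inL p) = node true (favouring p) allLeft
favouring (inR p) = node false allLeft (favouring p)

extend : ∀ {k} → Bool → V k → V (suc k)
extend _     root    = root
extend s     (inL q) = inL (extend s q)
extend s     (inR q) = inR (extend s q)
extend true  leaf    = inL leaf
extend false leaf    = inR leaf

shorten : ∀ {k} → V (suc k) → V k
shorten {zero}  _       = leaf
shorten {suc k} root    = root
shorten {suc k} (inL p) = inL (shorten p)
shorten {suc k} (inR p) = inR (shorten p)

shorten-extend : ∀ {k} s (q : V k) → shorten (extend s q) ≡ q
shorten-extend _     leaf    = refl
shorten-extend _     root    = refl
shorten-extend s     (inL q) = cong inL (shorten-extend s q)
shorten-extend s     (inR q) = cong inR (shorten-extend s q)

player-extend : ∀ {k} s {q : V k} → IsPlayer q → IsPlayer (extend s q)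
player-extend true  {leaf}  _        = player-inL leaf-player
player-extend false {leaf}  _        = player-inR leaf-player
player-extend _     {root}  q-player = ⊥-elim (root-not-player q-player)
player-extend s     {inL q} q-player = player-inL (player-extend s (player-unL q-player))
player-extend s     {inR q} q-player = player-inR (player-extend s (player-unR q-player))

family : ∀ k → V k → Picks (suc k)
family zero    p = node true (favouring p) done
family (suc k) p = node true (favouring p) (family k (shorten p))

player : ∀ k → Fin (2 ^ k) → V k
player zero    _ = leaf
player (suc k) i with remQuot {2} (2 ^ k) i
... | Fin.zero  , j = inL (player k j)
... | Fin.suc _ , j = inR (player k j)

player-surjective : ∀ {k} (p : V k) → IsPlayer p → ∃ λ i → player k i ≡ p
player-surjective leaf    _        = Fin.zero , refl
player-surjective root    p-player = ⊥-elim (root-not-player p-player)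
player-surjective {suc k} (inL p) p-player with player-surjective p (player-unL p-player)
... | j , refl = combine {2} Fin.zero j , player-at
  where
  player-at : player (suc k) (combine {2} Fin.zero j) ≡ inL (player k j)
  player-at rewrite remQuot-combine {2} {2 ^ k} Fin.zero j = refl
player-surjective {suc k} (inR p) p-player with player-surjective p (player-unR p-player)
... | j , refl = combine {2} (Fin.suc Fin.zero) j , player-at
  where
  player-at : player (suc k) (combine {2} (Fin.suc Fin.zero) j) ≡ inR (player k j)
  player-at rewrite remQuot-combine {2} {2 ^ k} (Fin.suc Fin.zero) j = refl

resolving-family : ∀ k → Fin (2 ^ k) → Bracket (suc k)
resolving-family k i = toBracket (family k (player k i))

lefts : ∀ {k} → List (V (suc k)) → List (V k)
lefts []             = []
lefts (root  ∷ xs)   = lefts xs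
lefts (inL v ∷ xs)   = v ∷ lefts xs
lefts (inR _ ∷ xs)   = lefts xs

rights : ∀ {k} → List (V (suc k)) → List (V k)
rights []            = []
rights (root  ∷ xs)  = rights xs
rights (inL _ ∷ xs)  = rights xs
rights (inR v ∷ xs)  = v ∷ rights xs

length-lefts+rights : ∀ {k} (xs : List (V (suc k))) → length (lefts xs) ℕ.+ length (rights xs) ℕ.≤ length xs
length-lefts+rights []           = ℕ.z≤n
length-lefts+rights (root  ∷ xs) = ℕ.m≤n⇒m≤1+n (length-lefts+rights xs)
length-lefts+rights (inL _ ∷ xs) = ℕ.s≤s (length-lefts+rights xs)
length-lefts+rights (inR _ ∷ xs) =
  ℕ.≤-trans (ℕ.≤-reflexive (ℕ.+-suc (length (lefts xs)) _)) (ℕ.s≤s (length-lefts+rights xs))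

∈-lefts : ∀ {k} (xs : List (V (suc k))) {v} → inL v ∈ xs → v ∈ lefts xs
∈-lefts (_     ∷ _)  (here refl) = here refl
∈-lefts (root  ∷ xs) (there v∈)  = ∈-lefts xs v∈
∈-lefts (inL _ ∷ xs) (there v∈)  = there (∈-lefts xs v∈)
∈-lefts (inR _ ∷ xs) (there v∈)  = ∈-lefts xs v∈

∈-rights : ∀ {k} (xs : List (V (suc k))) {v} → inR v ∈ xs → v ∈ rights xs
∈-rights (_     ∷ _)  (here refl) = here refl
∈-rights (root  ∷ xs) (there v∈)  = ∈-rights xs v∈
∈-rights (inL _ ∷ xs) (there v∈)  = ∈-rights xs v∈
∈-rights (inR _ ∷ xs) (there v∈)  = there (∈-rights xs v∈)

one-below-half : ∀ {a b c} → a ℕ.+ b ℕ.< c ℕ.+ c → a ℕ.< c ⊎ b ℕ.< c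
one-below-half {a} {b} {c} a+b<c+c with a ℕ.<? c
... | yes a<c = inj₁ a<c
... | no  a≮c = inj₂ (ℕ.+-cancelˡ-< c b c (ℕ.≤-<-trans (ℕ.+-monoˡ-≤ b (ℕ.≮⇒≥ a≮c)) a+b<c+c))

halves-short : ∀ {k} (xs : List (V (suc k))) → length xs ℕ.< 2 ^ suc k →
  length (lefts xs) ℕ.+ length (rights xs) ℕ.< 2 ^ k ℕ.+ 2 ^ k
halves-short {k} xs short = ℕ.≤-<-trans (length-lefts+rights xs)
  (subst (length xs ℕ.<_) (cong (2 ^ k ℕ.+_) (ℕ.+-identityʳ (2 ^ k))) short)

unpredicted : ∀ k (xs : List (V k)) → length xs ℕ.< 2 ^ k → Σ (Picks k) λ b → champion b ∉ xs
unpredicted zero    []      _ = done , λ ()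
unpredicted zero    (_ ∷ _) (ℕ.s≤s ())
unpredicted (suc k) xs short with one-below-half (halves-short xs short)
... | inj₁ lefts-short  = let b , b∉ = unpredicted k (lefts xs) lefts-short
                          in node true b allLeft , b∉ ∘ ∈-lefts xs
... | inj₂ rights-short = let b , b∉ = unpredicted k (rights xs) rights-short
                          in node false allLeft b , b∉ ∘ ∈-rights xs

unpredicted-finalists : ∀ k (xs : List (V (suc k))) → length xs ℕ.< 2 ^ k →
  Σ (Picks k) λ L → Σ (Picks k) λ R → inL (champion L) ∉ xs × inR (champion R) ∉ xs
unpredicted-finalists k xs short =
  let L , L∉ = unpredicted k (lefts xs) (ℕ.≤-<-trans (ℕ.≤-trans (ℕ.m≤m+n _ _) (length-lefts+rights xs)) short)
      R , R∉ = unpredicted k (rights xs) (ℕ.≤-<-trans (ℕ.≤-trans (ℕ.m≤n+m _ _) (length-lefts+rights xs)) short)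
  in L , R , L∉ ∘ ∈-lefts xs , R∉ ∘ ∈-rights xs

module _ (F : OrderedField) where
  open OrderedField F using (Carrier; _+_; -_; 0#; _<_; +-assoc; +-comm; +-identityˡ; -‿inverseˡ;
                             <-irrefl; <-trans; <-trichotomy; +-mono-<)
  open ≡-Reasoning

  +-abelianGroup : AbelianGroup 0ℓ 0ℓ
  +-abelianGroup = record
    { Carrier = Carrier
    ; _≈_ = _≡_
    ; _∙_ = _+_
    ; ε = 0#
    ; _⁻¹ = -_
    ; isAbelianGroup = record
      { isGroup = record
        { isMonoid = record
          { isSemigroup = record
            { isMagma = record { isEquivalence = isEquivalence ; ∙-cong = cong₂ _+_ }
            ; assoc = +-assoc
            }
          ; identity = comm∧idˡ⇒id +-comm +-identityˡ
          }
        ; inverse = comm∧invˡ⇒inv +-comm -‿inverseˡ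
        ; ⁻¹-cong = cong -_
        }
      ; comm = +-comm
      }
    }

  open AbelianGroup +-abelianGroup using (_-_; inverseʳ; commutativeSemigroup)
    renaming (identityʳ to +-identityʳ)
  open AbelianGroupProperties +-abelianGroup using (∙-cancelˡ; ∙-cancelʳ; ⁻¹-∙-comm; ε⁻¹≈ε; ⁻¹-injective)
  open CommutativeSemigroupProperties commutativeSemigroup using (interchange; x∙yz≈y∙xz)

  +-cancelˡ : ∀ {x y z} → x + y ≡ x + z → y ≡ z
  +-cancelˡ {x} {y} {z} = ∙-cancelˡ x y z

  +-cancelʳ : ∀ {x y} z → x + z ≡ y + z → x ≡ y
  +-cancelʳ {x} {y} z = ∙-cancelʳ z x y

  x-0≡x : ∀ x → x - 0# ≡ x
  x-0≡x x = trans (cong (x +_) ε⁻¹≈ε) (+-identityʳ x)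

  [x+z]-[y+z] : ∀ x y z → (x + z) - (y + z) ≡ x - y
  [x+z]-[y+z] x y z = begin
    (x + z) + - (y + z)     ≡⟨ cong ((x + z) +_) (⁻¹-∙-comm y z) ⟨
    (x + z) + (- y + - z)   ≡⟨ interchange x z (- y) (- z) ⟩
    (x - y) + (z - z)       ≡⟨ cong ((x - y) +_) (inverseʳ z) ⟩
    (x - y) + 0#            ≡⟨ +-identityʳ (x - y) ⟩
    x - y                   ∎

  [z+x]-[z+y] : ∀ x y z → (z + x) - (z + y) ≡ x - y
  [z+x]-[z+y] x y z = trans (cong₂ _-_ (+-comm z x) (+-comm z y)) ([x+z]-[y+z] x y z)

  differences-agree : ∀ {x x′ y y′ z z′} → x + z ≡ x′ + z′ → y + z ≡ y′ + z′ → x - y ≡ x′ - y′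
  differences-agree {x} {x′} {y} {y′} {z} {z′} x≡x′ y≡y′ = begin
    x - y                   ≡⟨ [x+z]-[y+z] x y z ⟨
    (x + z) - (y + z)       ≡⟨ cong₂ _-_ x≡x′ y≡y′ ⟩
    (x′ + z′) - (y′ + z′)   ≡⟨ [x+z]-[y+z] x′ y′ z′ ⟩
    x′ - y′                 ∎

  _≟_ : DecidableEquality Carrier
  x ≟ y with <-trichotomy x y
  ... | inj₁ x<y        = no λ { refl → <-irrefl x x<y }
  ... | inj₂ (inj₁ x≡y) = yes x≡y
  ... | inj₂ (inj₂ y<x) = no λ { refl → <-irrefl x y<x }

  pos⇒≢0 : ∀ {x} → 0# < x → x ≢ 0#
  pos⇒≢0 {x} 0<x refl = <-irrefl 0# 0<x

  pos+pos : ∀ {x y} → 0# < x → 0# < y → 0# < x + y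
  pos+pos {x} {y} 0<x 0<y = <-trans 0# y (x + y) 0<y (subst (_< x + y) (+-identityˡ y) (+-mono-< 0# x y 0<x))

  NonNeg : Carrier → Set
  NonNeg x = x ≡ 0# ⊎ 0# < x

  nonneg+pos : ∀ {x y} → NonNeg x → 0# < y → 0# < x + y
  nonneg+pos (inj₁ refl) 0<y = subst (0# <_) (sym (+-identityˡ _)) 0<y
  nonneg+pos (inj₂ 0<x)  0<y = pos+pos 0<x 0<y

  positive-inL : ∀ {k} {σ : V (suc k) → Carrier} → Positive F σ → Positive F (σ ∘ inL)
  positive-inL pos x (u , e) = pos (inL x) (inL u , liftL e)

  positive-inR : ∀ {k} {σ : V (suc k) → Carrier} → Positive F σ → Positive F (σ ∘ inR)
  positive-inR pos x (u , e) = pos (inR x) (inR u , liftR e)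

  positive-root : ∀ {k} {σ : V (suc k) → Carrier} → Positive F σ → 0# < σ root
  positive-root {k} pos = pos root (inL (top k) , eL)

  _when_ : Carrier → Bool → Carrier
  x when t = if t then x else 0#

  0-when : ∀ t → 0# when t ≡ 0#
  0-when true  = refl
  0-when false = refl

  when-∧ : ∀ x s t → x when (s ∧ t) ≡ (x when s) when t
  when-∧ x true  t = refl
  when-∧ x false t = sym (0-when t)

  when-merge : ∀ x y t z → x when t + (y when t + z) ≡ (x + y) when t + z
  when-merge x y true  z = sym (+-assoc x y z)
  when-merge x y false z = +-identityˡ (0# + z)

  when-nonneg : ∀ {x} → 0# < x → ∀ t → NonNeg (x when t)
  when-nonneg 0<x true  = inj₂ 0<x
  when-nonneg 0<x false = inj₁ refl

  when-injective : ∀ {x} → 0# < x → ∀ {t t′} → x when t ≡ x when t′ → t ≡ t′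
  when-injective 0<x {true}  {true}  _  = refl
  when-injective 0<x {true}  {false} eq = ⊥-elim (pos⇒≢0 0<x eq)
  when-injective 0<x {false} {true}  eq = ⊥-elim (pos⇒≢0 0<x (sym eq))
  when-injective 0<x {false} {false} _  = refl

  when-pair-injective : ∀ {x x′} → 0# < x → ∀ {t t′} →
    x when t ≡ x′ when t′ → x when not t ≡ x′ when not t′ → t ≡ t′ × x ≡ x′
  when-pair-injective 0<x {true}  {true}  eq _  = refl , eq
  when-pair-injective 0<x {true}  {false} eq _  = ⊥-elim (pos⇒≢0 0<x eq)
  when-pair-injective 0<x {false} {true}  _  eq = ⊥-elim (pos⇒≢0 0<x eq)
  when-pair-injective 0<x {false} {false} _  eq = refl , eq

  signed-injective : ∀ {x x′} → 0# < x → 0# < x′ → ∀ {t t′} →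
    x when t - x when not t ≡ x′ when t′ - x′ when not t′ → t ≡ t′ × x ≡ x′
  signed-injective {x} {x′} 0<x 0<x′ {true} {true} eq =
    refl , trans (sym (x-0≡x x)) (trans eq (x-0≡x x′))
  signed-injective {x} {x′} 0<x 0<x′ {true} {false} eq = ⊥-elim (pos⇒≢0 (pos+pos 0<x 0<x′) (begin
    x + x′         ≡⟨ cong (_+ x′) (trans (sym (x-0≡x x)) eq) ⟩
    (0# - x′) + x′ ≡⟨ cong (_+ x′) (+-identityˡ (- x′)) ⟩
    - x′ + x′      ≡⟨ -‿inverseˡ x′ ⟩
    0#             ∎))
  signed-injective {x} {x′} 0<x 0<x′ {false} {true} eq = ⊥-elim (pos⇒≢0 (pos+pos 0<x′ 0<x) (begin
    x′ + x         ≡⟨ cong (_+ x) (trans (sym (x-0≡x x′)) (sym eq)) ⟩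
    (0# - x) + x   ≡⟨ cong (_+ x) (+-identityˡ (- x)) ⟩
    - x + x        ≡⟨ -‿inverseˡ x ⟩
    0#             ∎))
  signed-injective {x} {x′} 0<x 0<x′ {false} {false} eq =
    refl , ⁻¹-injective (trans (sym (+-identityˡ (- x))) (trans eq (+-identityˡ (- x′))))

  scoreᵖ : ∀ {k} → (V k → Carrier) → Picks k → Picks k → Carrier
  scoreᵖ σ done done = 0#
  scoreᵖ σ b@(node _ l r) b′@(node _ l′ r′) =
    σ root when does (champion b ≟V champion b′) + (scoreᵖ (σ ∘ inL) l l′ + scoreᵖ (σ ∘ inR) r r′)

  sumOver : ∀ {A : Set} → (A → Carrier) → List A → Carrier
  sumOver c xs = foldr _+_ 0# (map c xs)

  sumOver-++ : ∀ {A : Set} (c : A → Carrier) xs ys → sumOver c (xs ++ ys) ≡ sumOver c xs + sumOver c ys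
  sumOver-++ c []       ys = sym (+-identityˡ _)
  sumOver-++ c (x ∷ xs) ys = trans (cong (c x +_) (sumOver-++ c xs ys)) (sym (+-assoc _ _ _))

  sumOver-map : ∀ {A B : Set} (c : B → Carrier) (f : A → B) xs → sumOver c (map f xs) ≡ sumOver (c ∘ f) xs
  sumOver-map c f xs = cong (foldr _+_ 0#) (sym (map-∘ xs))

  sumOver-cong : ∀ {A : Set} {c d : A → Carrier} → c ≗ d → ∀ xs → sumOver c xs ≡ sumOver d xs
  sumOver-cong c≗d xs = cong (foldr _+_ 0#) (map-cong c≗d xs)

  agreement : ∀ {k} → (V k → Carrier) → (V k → V k) → (V k → V k) → V k → Carrier
  agreement σ f g x = σ x when (does (isMatch? x) ∧ does (f x ≟V g x))

  agreement-cong : ∀ {k} (σ : V k → Carrier) {f f′ g g′ : V k → V k} → f ≗ f′ → g ≗ g′ →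
    agreement σ f g ≗ agreement σ f′ g′
  agreement-cong σ f≗f′ g≗g′ x rewrite f≗f′ x | g≗g′ x = refl

  -- `score` sums a function local to its where-block, which cannot be named; unification finds it.
  score-unfolded : ∀ {k} (σ : ScoringSystem F k) (B B′ : Bracket k) →
    Σ (V k → Carrier) λ c → score F σ B B′ ≡ sumOver c (vertices k)
  score-unfolded σ B B′ = _ , refl

  score-summand : ∀ {k} (σ : ScoringSystem F k) (B B′ : Bracket k) →
    proj₁ (score-unfolded σ B B′) ≗ agreement σ (fn B) (fn B′)
  score-summand σ B B′ x with isMatch? x | fn B x ≟V fn B′ x
  ... | yes _ | yes _ = refl
  ... | yes _ | no _  = refl
  ... | no _  | _     = refl

  sum-agreement-winner : ∀ k (σ : V k → Carrier) (b b′ : Picks k) →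
    sumOver (agreement σ (winner b) (winner b′)) (vertices k) ≡ scoreᵖ σ b b′
  sum-agreement-winner zero    σ done done = +-identityˡ 0#
  sum-agreement-winner (suc k) σ b@(node _ l r) b′@(node _ l′ r′) = begin
    c root + sumOver c (map inL vs ++ map inR vs)
      ≡⟨ cong (c root +_) (sumOver-++ c (map inL vs) (map inR vs)) ⟩
    c root + (sumOver c (map inL vs) + sumOver c (map inR vs))
      ≡⟨ cong (c root +_) (cong₂ _+_ (trans (sumOver-map c inL vs) (sumOver-cong on-inL vs))
                                     (trans (sumOver-map c inR vs) (sumOver-cong on-inR vs))) ⟩
    c root + (sumOver (agreement (σ ∘ inL) (winner l) (winner l′)) vs
               + sumOver (agreement (σ ∘ inR) (winner r) (winner r′)) vs)
      ≡⟨ cong (c root +_) (cong₂ _+_ (sum-agreement-winner k (σ ∘ inL) l l′)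
                                     (sum-agreement-winner k (σ ∘ inR) r r′)) ⟩
    scoreᵖ σ b b′ ∎
    where
    vs : List (V k)
    vs = vertices k
    c : V (suc k) → Carrier
    c = agreement σ (winner b) (winner b′)
    on-inL : c ∘ inL ≗ agreement (σ ∘ inL) (winner l) (winner l′)
    on-inL x = cong₂ (λ m e → σ (inL x) when (m ∧ e))
                     (does-isMatch?-inL x) (does-≟V-inL (winner l x) (winner l′ x))
    on-inR : c ∘ inR ≗ agreement (σ ∘ inR) (winner r) (winner r′)
    on-inR x = cong₂ (λ m e → σ (inR x) when (m ∧ e))
                     (does-isMatch?-inR x) (does-≟V-inR (winner r x) (winner r′ x))

  score≡scoreᵖ : ∀ {k} (σ : ScoringSystem F k) {B B′ : Bracket k} (b b′ : Picks k) →
    fn B ≗ winner b → fn B′ ≗ winner b′ → score F σ B B′ ≡ scoreᵖ σ b b′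
  score≡scoreᵖ {k} σ {B} {B′} b b′ B≗b B′≗b′ = begin
    score F σ B B′                                             ≡⟨ proj₂ (score-unfolded σ B B′) ⟩
    sumOver (proj₁ (score-unfolded σ B B′)) (vertices k)       ≡⟨ sumOver-cong (score-summand σ B B′) vs ⟩
    sumOver (agreement σ (fn B) (fn B′)) (vertices k)          ≡⟨ sumOver-cong (agreement-cong σ B≗b B′≗b′) vs ⟩
    sumOver (agreement σ (winner b) (winner b′)) (vertices k)  ≡⟨ sum-agreement-winner k σ b b′ ⟩
    scoreᵖ σ b b′                                              ∎
    where
    vs : List (V k)
    vs = vertices k

  -- The weight β stands for the matches above the subtree won by the subtree's
  -- champion in both brackets: it is earned exactly when l's champion is p.
  gain : ∀ {k} → (V k → Carrier) → Carrier → V k → Picks k → Carrier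
  gain τ β p l = β when does (champion (favouring p) ≟V champion l) + scoreᵖ τ (favouring p) l

  gain-leaf : ∀ (τ : V zero → Carrier) β → gain τ β leaf done ≡ β
  gain-leaf τ β = +-identityʳ β

  gain-node : ∀ {k} (τ : V (suc k) → Carrier) β p t (l r Y : Picks k) →
    β when does (inL (champion (favouring p)) ≟V champion (node t l r))
      + scoreᵖ τ (node true (favouring p) Y) (node t l r)
    ≡ gain (τ ∘ inL) ((β + τ root) when t) p l + scoreᵖ (τ ∘ inR) Y r
  gain-node τ β p t l r Y = begin
    β when d′ + (τ root when d′ + (scoreᵖ (τ ∘ inL) (favouring p) l + scoreᵖ (τ ∘ inR) Y r))
      ≡⟨ when-merge β (τ root) d′ _ ⟩
    (β + τ root) when d′ + (scoreᵖ (τ ∘ inL) (favouring p) l + scoreᵖ (τ ∘ inR) Y r)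
      ≡⟨ cong (_+ _) (trans (cong ((β + τ root) when_) (does-≟-champion-inL _ t l r)) (when-∧ _ t _)) ⟩
    ((β + τ root) when t) when d + (scoreᵖ (τ ∘ inL) (favouring p) l + scoreᵖ (τ ∘ inR) Y r)
      ≡⟨ +-assoc _ _ _ ⟨
    gain (τ ∘ inL) ((β + τ root) when t) p l + scoreᵖ (τ ∘ inR) Y r ∎
    where
    d′ d : Bool
    d′ = does (inL (champion (favouring p)) ≟V champion (node t l r))
    d  = does (champion (favouring p) ≟V champion l)

  gain-inL : ∀ {k} (τ : V (suc k) → Carrier) β p t (l r : Picks k) →
    gain τ β (inL p) (node t l r) ≡ gain (τ ∘ inL) ((β + τ root) when t) p l + scoreᵖ (τ ∘ inR) allLeft r
  gain-inL τ β p t l r = gain-node τ β p t l r allLeft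

  gain-inR : ∀ {k} (τ : V (suc k) → Carrier) β p t (l r : Picks k) →
    gain τ β (inR p) (node t l r) ≡ scoreᵖ (τ ∘ inL) allLeft l + gain (τ ∘ inR) ((β + τ root) when not t) p r
  gain-inR τ β p t l r = begin
    β when d′ + (τ root when d′ + (scoreᵖ (τ ∘ inL) allLeft l + scoreᵖ (τ ∘ inR) (favouring p) r))
      ≡⟨ when-merge β (τ root) d′ _ ⟩
    (β + τ root) when d′ + (scoreᵖ (τ ∘ inL) allLeft l + scoreᵖ (τ ∘ inR) (favouring p) r)
      ≡⟨ cong (_+ _) (trans (cong ((β + τ root) when_) (does-≟-champion-inR _ t l r)) (when-∧ _ (not t) _)) ⟩
    ((β + τ root) when not t) when d + (scoreᵖ (τ ∘ inL) allLeft l + scoreᵖ (τ ∘ inR) (favouring p) r)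
      ≡⟨ x∙yz≈y∙xz _ _ _ ⟩
    scoreᵖ (τ ∘ inL) allLeft l + gain (τ ∘ inR) ((β + τ root) when not t) p r ∎
    where
    d′ d : Bool
    d′ = does (inR (champion (favouring p)) ≟V champion (node t l r))
    d  = does (champion (favouring p) ≟V champion r)

  score-favouring-node : ∀ {k} (σ : V (suc k) → Carrier) p s (l r Y : Picks k) →
    scoreᵖ σ (node true (favouring p) Y) (node s l r)
      ≡ gain (σ ∘ inL) (σ root when s) p l + scoreᵖ (σ ∘ inR) Y r
  score-favouring-node σ p s l r Y = begin
    scoreᵖ σ (node true (favouring p) Y) (node s l r)
      ≡⟨ trans (cong (_+ S) (0-when d′)) (+-identityˡ S) ⟨
    0# when d′ + scoreᵖ σ (node true (favouring p) Y) (node s l r)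
      ≡⟨ gain-node σ 0# p s l r Y ⟩
    gain (σ ∘ inL) ((0# + σ root) when s) p l + scoreᵖ (σ ∘ inR) Y r
      ≡⟨ cong (λ x → gain (σ ∘ inL) (x when s) p l + scoreᵖ (σ ∘ inR) Y r) (+-identityˡ (σ root)) ⟩
    gain (σ ∘ inL) (σ root when s) p l + scoreᵖ (σ ∘ inR) Y r ∎
    where
    d′ : Bool
    d′ = does (inL (champion (favouring p)) ≟V champion (node s l r))
    S : Carrier
    S = scoreᵖ σ (node true (favouring p) Y) (node s l r)

  δ : ∀ {k} → (V (suc k) → Carrier) → Carrier → V k → Picks (suc k) → Carrier
  δ τ β q l = gain τ β (extend true q) l - gain τ β (extend false q) l

  δ-leaf : ∀ (τ : V 1 → Carrier) β t →
    δ τ β leaf (node t done done) ≡ (β + τ root) when t - (β + τ root) when not t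
  δ-leaf τ β t = cong₂ _-_
    (trans (gain-inL τ β leaf t done done) (trans (+-identityʳ _) (gain-leaf (τ ∘ inL) _)))
    (trans (gain-inR τ β leaf t done done) (trans (+-identityˡ _) (gain-leaf (τ ∘ inR) _)))

  δ-inL : ∀ {k} (τ : V (suc (suc k)) → Carrier) β q t (l r : Picks (suc k)) →
    δ τ β (inL q) (node t l r) ≡ δ (τ ∘ inL) ((β + τ root) when t) q l
  δ-inL τ β q t l r = trans
    (cong₂ _-_ (gain-inL τ β (extend true q) t l r) (gain-inL τ β (extend false q) t l r))
    ([x+z]-[y+z] _ _ _)

  δ-inR : ∀ {k} (τ : V (suc (suc k)) → Carrier) β q t (l r : Picks (suc k)) →
    δ τ β (inR q) (node t l r) ≡ δ (τ ∘ inR) ((β + τ root) when not t) q r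
  δ-inR τ β q t l r = trans
    (cong₂ _-_ (gain-inR τ β (extend true q) t l r) (gain-inR τ β (extend false q) t l r))
    ([z+x]-[z+y] _ _ _)

  δ-injective : ∀ j (τ : V (suc j) → Carrier) → Positive F τ → ∀ {β β′} → NonNeg β → NonNeg β′ →
    (l l′ : Picks (suc j)) → (∀ q → IsPlayer q → δ τ β q l ≡ δ τ β′ q l′) → l ≡ l′ × β ≡ β′
  δ-injective zero τ pos {β} {β′} β≥0 β′≥0 (node t done done) (node t′ done done) same
    with signed-injective (nonneg+pos β≥0 (positive-root pos)) (nonneg+pos β′≥0 (positive-root pos))
           (trans (sym (δ-leaf τ β t)) (trans (same leaf leaf-player) (δ-leaf τ β′ t′)))
  ... | refl , eq = refl , +-cancelʳ (τ root) eq
  δ-injective (suc j) τ pos {β′ = β′} β≥0 β′≥0 (node t l r) (node t′ l′ r′) same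
    with nonneg+pos β≥0 (positive-root pos) | nonneg+pos β′≥0 (positive-root pos)
  ... | 0<a | 0<a′
    with δ-injective j (τ ∘ inL) (positive-inL pos) (when-nonneg 0<a t) (when-nonneg 0<a′ t′) l l′
           (λ q q-player → trans (sym (δ-inL τ _ q t l r))
                             (trans (same (inL q) (player-inL q-player)) (δ-inL τ _ q t′ l′ r′)))
       | δ-injective j (τ ∘ inR) (positive-inR pos) (when-nonneg 0<a (not t)) (when-nonneg 0<a′ (not t′)) r r′
           (λ q q-player → trans (sym (δ-inR τ _ q t l r))
                             (trans (same (inR q) (player-inR q-player)) (δ-inR τ _ q t′ l′ r′)))
  ... | refl , eqˡ | refl , eqʳ with when-pair-injective {x′ = β′ + τ root} 0<a {t} {t′} eqˡ eqʳ
  ... | refl , eq = refl , +-cancelʳ (τ root) eq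

  Indistinguishable : ∀ {k} → (V (suc k) → Carrier) → Picks (suc k) → Picks (suc k) → Set
  Indistinguishable {k} σ b b′ = ∀ p → IsPlayer p → scoreᵖ σ (family k p) b ≡ scoreᵖ σ (family k p) b′

  sibling-scores : ∀ {k} (σ : V (suc (suc k)) → Carrier) {s s′ l l′ r r′} →
    Indistinguishable σ (node s l r) (node s′ l′ r′) → ∀ b {q} → IsPlayer q →
    gain (σ ∘ inL) (σ root when s) (extend b q) l + scoreᵖ (σ ∘ inR) (family k q) r
      ≡ gain (σ ∘ inL) (σ root when s′) (extend b q) l′ + scoreᵖ (σ ∘ inR) (family k q) r′
  sibling-scores {k} σ {s} {s′} {l} {l′} {r} {r′} same b {q} q-player =
    subst (λ q′ → left-gain s l + right-score q′ r ≡ left-gain s′ l′ + right-score q′ r′) (shorten-extend b q)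
      (begin
        left-gain s l + right-score (shorten p) r     ≡⟨ score-favouring-node σ p s l r right-half ⟨
        scoreᵖ σ (family (suc k) p) (node s l r)      ≡⟨ same p (player-extend b q-player) ⟩
        scoreᵖ σ (family (suc k) p) (node s′ l′ r′)   ≡⟨ score-favouring-node σ p s′ l′ r′ right-half ⟩
        left-gain s′ l′ + right-score (shorten p) r′  ∎)
    where
    p : V (suc k)
    p = extend b q
    right-half : Picks (suc k)
    right-half = family k (shorten p)
    left-gain : Bool → Picks (suc k) → Carrier
    left-gain t l = gain (σ ∘ inL) (σ root when t) p l
    right-score : V k → Picks (suc k) → Carrier
    right-score q′ r = scoreᵖ (σ ∘ inR) (family k q′) r

  family-injective : ∀ k (σ : V (suc k) → Carrier) → Positive F σ →
    {b b′ : Picks (suc k)} → Indistinguishable σ b b′ → b ≡ b′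
  family-injective zero σ pos {node s done done} {node s′ done done} same =
    cong (λ t → node t done done) (when-injective (positive-root pos) (begin
      σ root when s                                   ≡⟨ final-weight s ⟨
      scoreᵖ σ (family zero leaf) (node s done done)  ≡⟨ same leaf leaf-player ⟩
      scoreᵖ σ (family zero leaf) (node s′ done done) ≡⟨ final-weight s′ ⟩
      σ root when s′                                  ∎))
    where
    final-weight : ∀ t → scoreᵖ σ (family zero leaf) (node t done done) ≡ σ root when t
    final-weight t = trans (score-favouring-node σ leaf t done done done)
                           (trans (+-identityʳ _) (gain-leaf (σ ∘ inL) (σ root when t)))
  family-injective (suc k) σ pos {node s l r} {node s′ l′ r′} same
    with δ-injective k (σ ∘ inL) (positive-inL pos)
           (when-nonneg (positive-root pos) s) (when-nonneg (positive-root pos) s′) l l′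
           (λ q q-player → differences-agree (sibling-scores σ {s} {s′} same true q-player)
                                             (sibling-scores σ {s} {s′} same false q-player))
  ... | refl , final-eq with when-injective (positive-root pos) final-eq
  ... | refl = cong (node s l) (family-injective k (σ ∘ inR) (positive-inR pos)
                 (λ q q-player → +-cancelˡ (sibling-scores σ {s} {s} same true q-player)))

  score-toBracketʳ : ∀ {k} (σ : ScoringSystem F k) (B : Bracket k) b →
    score F σ B (toBracket b) ≡ scoreᵖ σ (picks B) b
  score-toBracketʳ σ B b = score≡scoreᵖ σ (picks B) b (picks-correct B) (λ _ → refl)

  score-toBracketˡ : ∀ {k} (σ : ScoringSystem F k) b (B : Bracket k) →
    score F σ (toBracket b) B ≡ scoreᵖ σ b (picks B)
  score-toBracketˡ σ b B = score≡scoreᵖ σ b (picks B) (λ _ → refl) (picks-correct B)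

  family-resolving : ∀ k (σ : ScoringSystem F (suc k)) → Positive F σ → Resolving F σ (resolving-family k)
  family-resolving k σ pos B B′ distinct = ¬∀⟶∃¬ (2 ^ k) _ (λ i → _ ≟ _) (distinct ∘ same-brackets)
    where
    SameScores : Set
    SameScores = ∀ i → score F σ (resolving-family k i) B ≡ score F σ (resolving-family k i) B′

    indistinguishable : SameScores → Indistinguishable σ (picks B) (picks B′)
    indistinguishable same p p-player with player-surjective p p-player
    ... | i , refl = trans (sym (score-toBracketˡ σ (family k p) B))
                           (trans (same i) (score-toBracketˡ σ (family k p) B′))

    same-brackets : SameScores → fn B ≗ fn B′
    same-brackets same v = begin
      fn B v               ≡⟨ picks-correct B v ⟩
      winner (picks B) v   ≡⟨ cong (λ b → winner b v) (family-injective k σ pos (indistinguishable same)) ⟩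
      winner (picks B′) v  ≡⟨ picks-correct B′ v ⟨
      fn B′ v              ∎

  final-swap-invisible : ∀ {k} (σ : V (suc k) → Carrier) (b : Picks (suc k)) (L R : Picks k) →
    champion b ≢ inL (champion L) → champion b ≢ inR (champion R) →
    scoreᵖ σ b (node true L R) ≡ scoreᵖ σ b (node false L R)
  final-swap-invisible σ b@(node _ _ _) L R ≢L ≢R =
    cong (λ t → σ root when t + _)
         (trans (dec-false (champion b ≟V _) ≢L) (sym (dec-false (champion b ≟V _) ≢R)))

  unpredicted-finalists-unresolved : ∀ {k m} (σ : ScoringSystem F (suc k)) (ℬ : Fin m → Bracket (suc k))
    (L R : Picks k) → (∀ i → champion (picks (ℬ i)) ≢ inL (champion L)) →
    (∀ i → champion (picks (ℬ i)) ≢ inR (champion R)) → ¬ Resolving F σ ℬ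
  unpredicted-finalists-unresolved σ ℬ L R ≢L ≢R resolving
    with resolving (toBracket (node true L R)) (toBracket (node false L R)) (λ same → inL≢inR (same root))
  ... | i , differs = differs (begin
    score F σ (ℬ i) (toBracket (node true L R))   ≡⟨ score-toBracketʳ σ (ℬ i) (node true L R) ⟩
    scoreᵖ σ (picks (ℬ i)) (node true L R)        ≡⟨ final-swap-invisible σ (picks (ℬ i)) L R (≢L i) (≢R i) ⟩
    scoreᵖ σ (picks (ℬ i)) (node false L R)       ≡⟨ score-toBracketʳ σ (ℬ i) (node false L R) ⟨
    score F σ (ℬ i) (toBracket (node false L R))  ∎)

  few-brackets-unresolved : ∀ k {m} (σ : ScoringSystem F (suc k)) (ℬ : Fin m → Bracket (suc k)) →
    m ℕ.< 2 ^ k → ¬ Resolving F σ ℬ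
  few-brackets-unresolved k σ ℬ m<2^k =
    let L , R , L∉ , R∉ = unpredicted-finalists k predicted (subst (ℕ._< 2 ^ k) (sym (length-tabulate _)) m<2^k)
    in unpredicted-finalists-unresolved σ ℬ L R
         (λ i eq → L∉ (subst (_∈ predicted) eq (∈-tabulate⁺ i)))
         (λ i eq → R∉ (subst (_∈ predicted) eq (∈-tabulate⁺ i)))
    where
    predicted : List (V (suc k))
    predicted = tabulate (λ i → champion (picks (ℬ i)))

  lower-bound : ∀ k (σ : ScoringSystem F (suc k)) m (ℬ : Fin m → Bracket (suc k)) →
    Resolving F σ ℬ → 2 ^ k ℕ.≤ m
  lower-bound k σ m ℬ resolving = ℕ.≮⇒≥ λ m<2^k → few-brackets-unresolved k σ ℬ m<2^k resolving

theorem1p5 : (F : OrderedField) (k : ℕ) →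
    ((σ : ScoringSystem F (suc k)) → Positive F σ → DimEq F σ (2 ^ k)) ×
    Σ (Fin (2 ^ k) → Bracket (suc k))
      (λ ℬ → (σ : ScoringSystem F (suc k)) → Positive F σ → Resolving F σ ℬ)
theorem1p5 F k =
  (λ σ pos → (resolving-family k , family-resolving F k σ pos) , lower-bound F k σ) ,
  (resolving-family k , family-resolving F k)
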